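{- If $G$ and $H$ are digraphs, then $\gamma(G\mathbin{\Box} H)\ge\max\{\gamma(G)\rho(H),\gamma(H)\rho(G)\}$.
   Context: All digraphs are finite, and their arc relation is irreflexive. For a digraph $D$ and vertex $v$, $N^+_D[v]$ is $v$ together with its out-neighbors and $N^-_D[v]$ is $v$ together with its in-neighbors. A set $S\subseteq V(D)$ is dominating if $\bigcup_{v\in S}N^+_D[v]=V(D)$; $\gamma(D)$ is the minimum size of a dominating set. A set $P$ is a packing if $N^-_D[x]\cap N^-_D[y]=\emptyset$ for all distinct $x,y\in P$; $\rho(D)$ is the maximum size of a packing. The Cartesian product $G\mathbin{\Box} H$ has vertex set $V(G)\times V(H)$, with an arc from $(g_1,h_1)$ to $(g_2,h_2)$ iff either $g_1=g_2$ and $h_1h_2\in A(H)$, or $h_1=h_2$ and $g_1g_2\in A(G)$. -}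

module Defs where

open import Data.Nat using (ℕ; _≤_; _*_; _⊔_)
open import Data.Fin using (Fin; remQuot)
open import Data.Fin.Subset using (Subset; _∈_; ∣_∣)
open import Data.Product using (Σ; ∃; _×_; _,_; proj₁; proj₂)
open import Data.Sum using (_⊎_)
open import Data.Empty using (⊥)
open import Relation.Nullary using (¬_)
open import Relation.Binary.PropositionalEquality using (_≡_)

record Digraph : Set₁ where
  field
    n     : ℕ
    Arc   : Fin n → Fin n → Set
    irrefl : ∀ v → ¬ Arc v v
open Digraph public

InOutNbhd : (D : Digraph) → Fin (n D) → Fin (n D) → Set
InOutNbhd D v u = (u ≡ v) ⊎ Arc D v u

InInNbhd : (D : Digraph) → Fin (n D) → Fin (n D) → Set
InInNbhd D v u = (u ≡ v) ⊎ Arc D u v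

Dominating : (D : Digraph) → Subset (n D) → Set
Dominating D S = ∀ u → ∃ λ v → v ∈ S × InOutNbhd D v u

Packing : (D : Digraph) → Subset (n D) → Set
Packing D P = ∀ x y → x ∈ P → y ∈ P → ¬ (x ≡ y) →
              ∀ z → InInNbhd D x z → InInNbhd D y z → ⊥

IsDominationNumber : Digraph → ℕ → Set
IsDominationNumber D k =
  (Σ (Subset (n D)) λ S → Dominating D S × ∣ S ∣ ≡ k) ×
  (∀ S → Dominating D S → k ≤ ∣ S ∣)

IsPackingNumber : Digraph → ℕ → Set
IsPackingNumber D k =
  (Σ (Subset (n D)) λ P → Packing D P × ∣ P ∣ ≡ k) ×
  (∀ P → Packing D P → ∣ P ∣ ≤ k)

-- Cartesian product G □ H, with vertex set Fin (n G * n H) identified with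
-- Fin (n G) × Fin (n H) via the bijection remQuot.
cartArc : (G H : Digraph) → Fin (n G) × Fin (n H) → Fin (n G) × Fin (n H) → Set
cartArc G H (g₁ , h₁) (g₂ , h₂) = (g₁ ≡ g₂ × Arc H h₁ h₂) ⊎ (h₁ ≡ h₂ × Arc G g₁ g₂)

cartIrrefl : (G H : Digraph) → ∀ p → ¬ cartArc G H p p
cartIrrefl G H (g , h) (Data.Sum.inj₁ (_ , a)) = irrefl H h a
cartIrrefl G H (g , h) (Data.Sum.inj₂ (_ , a)) = irrefl G g a

_□_ : Digraph → Digraph → Digraph
G □ H = record
  { n = n G * n H
  ; Arc = λ u v → cartArc G H (remQuot (n H) u) (remQuot (n H) v)
  ; irrefl = λ v → cartIrrefl G H (remQuot (n H) v)
  }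

-- Let D dominate G □ H and let P be a packing of H. For h ∈ P, choose for
-- each g a vertex of D dominating (g , h); its H-coordinate lies in N⁻_H[h]
-- and its G-coordinate dominates g. So the chosen vertices form a set D_h ⊆ D
-- whose projection to G dominates G, whence |D_h| ≥ γ(G); and the sets D_h
-- are pairwise disjoint because the N⁻_H[h], h ∈ P, are.
module Submission where

open import Defs
open import Data.Nat using (ℕ; suc; _≤_; _*_; _⊔_; _+_; z≤n; s≤s)
open import Data.Nat.Properties
  using (≤-trans; ≤-reflexive; +-suc; +-monoʳ-≤; +-mono-≤; *-comm; *-identityʳ; ⊔-lub)
open import Data.Fin using (Fin; zero; suc; combine; remQuot)
open import Data.Fin.Properties using (suc-injective; remQuot-combine)
open import Data.Fin.Subset using (Subset; _∈_; ∣_∣; inside; outside; _∪_; ⁅_⁆; ⊥; ⊤; _⊆_)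
open import Data.Fin.Subset.Properties
  using (∣p∣≤∣x∷p∣; ∣⊥∣≡0; ∣⁅x⁆∣≡1; x∈⁅x⁆; x∈⁅y⁆⇒x≡y; x∈p∪q⁻; x∈p∪q⁺; ∈⊤; ∉⊥; p⊆q⇒∣p∣≤∣q∣)
open import Data.Vec using (_∷_; []; here; there)
open import Data.Product using (∃; _×_; _,_; proj₁; proj₂)
open import Data.Sum using (_⊎_; inj₁; inj₂)
open import Data.Empty using (⊥-elim) renaming (⊥ to Empty)
open import Function using (_∘_)
open import Relation.Binary.PropositionalEquality using (_≡_; _≢_; refl; sym; trans; cong; subst)

private
  variable
    m k : ℕ

∣p∪q∣≤∣p∣+∣q∣ : (p q : Subset k) → ∣ p ∪ q ∣ ≤ ∣ p ∣ + ∣ q ∣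
∣p∪q∣≤∣p∣+∣q∣ []            []            = z≤n
∣p∪q∣≤∣p∣+∣q∣ (inside ∷ p)  (t ∷ q)       =
  s≤s (≤-trans (∣p∪q∣≤∣p∣+∣q∣ p q) (+-monoʳ-≤ ∣ p ∣ (∣p∣≤∣x∷p∣ t q)))
∣p∪q∣≤∣p∣+∣q∣ (outside ∷ p) (inside ∷ q)  rewrite +-suc ∣ p ∣ ∣ q ∣ = s≤s (∣p∪q∣≤∣p∣+∣q∣ p q)
∣p∪q∣≤∣p∣+∣q∣ (outside ∷ p) (outside ∷ q) = ∣p∪q∣≤∣p∣+∣q∣ p q

Disjoint : Subset k → Subset k → Set
Disjoint p q = ∀ {x} → x ∈ p → x ∈ q → Empty

disjoint⇒∣p∣+∣q∣≤∣p∪q∣ : (p q : Subset k) → Disjoint p q → ∣ p ∣ + ∣ q ∣ ≤ ∣ p ∪ q ∣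
disjoint⇒∣p∣+∣q∣≤∣p∪q∣ []            []            _  = z≤n
disjoint⇒∣p∣+∣q∣≤∣p∪q∣ (inside ∷ p)  (inside ∷ q)  pq = ⊥-elim (pq here here)
disjoint⇒∣p∣+∣q∣≤∣p∪q∣ (inside ∷ p)  (outside ∷ q) pq =
  s≤s (disjoint⇒∣p∣+∣q∣≤∣p∪q∣ p q (λ x∈p x∈q → pq (there x∈p) (there x∈q)))
disjoint⇒∣p∣+∣q∣≤∣p∪q∣ (outside ∷ p) (inside ∷ q)  pq rewrite +-suc ∣ p ∣ ∣ q ∣ =
  s≤s (disjoint⇒∣p∣+∣q∣≤∣p∪q∣ p q (λ x∈p x∈q → pq (there x∈p) (there x∈q)))
disjoint⇒∣p∣+∣q∣≤∣p∪q∣ (outside ∷ p) (outside ∷ q) pq =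
  disjoint⇒∣p∣+∣q∣≤∣p∪q∣ p q (λ x∈p x∈q → pq (there x∈p) (there x∈q))

⋃-over : Subset m → (Fin m → Subset k) → Subset k
⋃-over []            T = ⊥
⋃-over (inside ∷ P)  T = T zero ∪ ⋃-over P (T ∘ suc)
⋃-over (outside ∷ P) T = ⋃-over P (T ∘ suc)

∈-⋃-over⁺ : ∀ {P : Subset m} {T : Fin m → Subset k} {y x} →
            y ∈ P → x ∈ T y → x ∈ ⋃-over P T
∈-⋃-over⁺ {P = inside ∷ P}              here        x∈Ty = x∈p∪q⁺ (inj₁ x∈Ty)
∈-⋃-over⁺ {P = inside ∷ P}              (there y∈P) x∈Ty = x∈p∪q⁺ (inj₂ (∈-⋃-over⁺ {P = P} y∈P x∈Ty))
∈-⋃-over⁺ {P = outside ∷ P} {y = suc y} (there y∈P) x∈Ty = ∈-⋃-over⁺ {P = P} y∈P x∈Ty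

∈-⋃-over⁻ : (P : Subset m) (T : Fin m → Subset k) {x : Fin k} →
            x ∈ ⋃-over P T → ∃ λ y → y ∈ P × x ∈ T y
∈-⋃-over⁻ []            T x∈⋃ = ⊥-elim (∉⊥ x∈⋃)
∈-⋃-over⁻ (inside ∷ P)  T x∈⋃ with x∈p∪q⁻ (T zero) (⋃-over P (T ∘ suc)) x∈⋃
... | inj₁ x∈T₀ = zero , here , x∈T₀
... | inj₂ x∈⋃′ with ∈-⋃-over⁻ P (T ∘ suc) x∈⋃′
...   | y , y∈P , x∈Ty = suc y , there y∈P , x∈Ty
∈-⋃-over⁻ (outside ∷ P) T x∈⋃ with ∈-⋃-over⁻ P (T ∘ suc) x∈⋃
... | y , y∈P , x∈Ty = suc y , there y∈P , x∈Ty

∣⋃-over∣≤ : ∀ c (P : Subset m) (T : Fin m → Subset k) →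
            (∀ {y} → y ∈ P → ∣ T y ∣ ≤ c) → ∣ ⋃-over P T ∣ ≤ ∣ P ∣ * c
∣⋃-over∣≤ {k = k} c [] T _ rewrite ∣⊥∣≡0 k = z≤n
∣⋃-over∣≤ c (inside ∷ P)  T ∣T∣≤c =
  ≤-trans (∣p∪q∣≤∣p∣+∣q∣ (T zero) (⋃-over P (T ∘ suc)))
          (+-mono-≤ (∣T∣≤c here) (∣⋃-over∣≤ c P (T ∘ suc) (∣T∣≤c ∘ there)))
∣⋃-over∣≤ c (outside ∷ P) T ∣T∣≤c = ∣⋃-over∣≤ c P (T ∘ suc) (∣T∣≤c ∘ there)

PairwiseDisjointOn : Subset m → (Fin m → Subset k) → Set
PairwiseDisjointOn P T = ∀ {x y} → x ∈ P → y ∈ P → x ≢ y → Disjoint (T x) (T y)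

pairwiseDisjointOn-tail : ∀ {t} {P : Subset m} {T : Fin (suc m) → Subset k} →
                          PairwiseDisjointOn (t ∷ P) T → PairwiseDisjointOn P (T ∘ suc)
pairwiseDisjointOn-tail disjoint x∈P y∈P x≢y = disjoint (there x∈P) (there y∈P) (x≢y ∘ suc-injective)

∣P∣*c≤∣⋃-over∣ : ∀ c (P : Subset m) (T : Fin m → Subset k) →
                 (∀ {y} → y ∈ P → c ≤ ∣ T y ∣) → PairwiseDisjointOn P T →
                 ∣ P ∣ * c ≤ ∣ ⋃-over P T ∣
∣P∣*c≤∣⋃-over∣ c []            T _      _        = z≤n
∣P∣*c≤∣⋃-over∣ c (inside ∷ P)  T c≤∣T∣ disjoint =
  ≤-trans (+-mono-≤ (c≤∣T∣ here)
                    (∣P∣*c≤∣⋃-over∣ c P (T ∘ suc) (c≤∣T∣ ∘ there) (pairwiseDisjointOn-tail disjoint)))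
          (disjoint⇒∣p∣+∣q∣≤∣p∪q∣ (T zero) (⋃-over P (T ∘ suc)) T₀-disjoint-rest)
  where
  T₀-disjoint-rest : Disjoint (T zero) (⋃-over P (T ∘ suc))
  T₀-disjoint-rest x∈T₀ x∈⋃ with ∈-⋃-over⁻ P (T ∘ suc) x∈⋃
  ... | y , y∈P , x∈Ty = disjoint here (there y∈P) (λ ()) x∈T₀ x∈Ty
∣P∣*c≤∣⋃-over∣ c (outside ∷ P) T c≤∣T∣ disjoint =
  ∣P∣*c≤∣⋃-over∣ c P (T ∘ suc) (c≤∣T∣ ∘ there) (pairwiseDisjointOn-tail disjoint)

image : (Fin m → Fin k) → Subset m → Subset k
image f S = ⋃-over S (⁅_⁆ ∘ f)

∈-image⁺ : ∀ (f : Fin m → Fin k) {S x} → x ∈ S → f x ∈ image f S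
∈-image⁺ f {S} x∈S = ∈-⋃-over⁺ {P = S} x∈S (x∈⁅x⁆ (f _))

∈-image⁻ : ∀ (f : Fin m → Fin k) S {y} → y ∈ image f S → ∃ λ x → x ∈ S × f x ≡ y
∈-image⁻ f S y∈fS with ∈-⋃-over⁻ S (⁅_⁆ ∘ f) y∈fS
... | x , x∈S , y∈⁅fx⁆ = x , x∈S , sym (x∈⁅y⁆⇒x≡y (f x) y∈⁅fx⁆)

∣image∣≤ : ∀ (f : Fin m → Fin k) S → ∣ image f S ∣ ≤ ∣ S ∣
∣image∣≤ f S = subst (∣ image f S ∣ ≤_) (*-identityʳ ∣ S ∣)
  (∣⋃-over∣≤ 1 S (⁅_⁆ ∘ f) (λ {y} _ → subst (_≤ 1) (sym (∣⁅x⁆∣≡1 (f y))) (s≤s z≤n)))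

-- What a dominating set of G □ H provides, read through its two coordinate
-- projections; abstracting it lets one counting argument serve both factor orders.
LayerDominating : (G H : Digraph) → (Fin m → Fin (n G)) → (Fin m → Fin (n H)) → Subset m → Set
LayerDominating G H pG pH D =
  ∀ g h → ∃ λ d → d ∈ D × InOutNbhd G (pG d) g × InInNbhd H h (pH d)

layerDominating⇒∣P∣*γ≤∣D∣ :
  (G H : Digraph) {pG : Fin m → Fin (n G)} {pH : Fin m → Fin (n H)} {D : Subset m} (γ : ℕ) →
  LayerDominating G H pG pH D → (∀ S → Dominating G S → γ ≤ ∣ S ∣) →
  ∀ {P} → Packing H P → ∣ P ∣ * γ ≤ ∣ D ∣
layerDominating⇒∣P∣*γ≤∣D∣ {m} G H {pG} {pH} {D} γ cover γ≤ {P} packing =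
  ≤-trans (∣P∣*c≤∣⋃-over∣ γ P layer (λ _ → γ≤∣layer∣) layers-disjoint)
          (p⊆q⇒∣p∣≤∣q∣ ⋃-layers⊆D)
  where
  chosen : Fin (n H) → Fin (n G) → Fin m
  chosen h g = proj₁ (cover g h)

  layer : Fin (n H) → Subset m
  layer h = image (chosen h) ⊤

  layer⊆D : ∀ {h} → layer h ⊆ D
  layer⊆D {h} d∈layer with ∈-image⁻ (chosen h) ⊤ d∈layer
  ... | g , _ , refl = proj₁ (proj₂ (cover g h))

  layer-over-nbhd : ∀ {h d} → d ∈ layer h → InInNbhd H h (pH d)
  layer-over-nbhd {h} d∈layer with ∈-image⁻ (chosen h) ⊤ d∈layer
  ... | g , _ , refl = proj₂ (proj₂ (proj₂ (cover g h)))

  image-layer-dominating : ∀ h → Dominating G (image pG (layer h))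
  image-layer-dominating h g =
    pG (chosen h g) , ∈-image⁺ pG (∈-image⁺ (chosen h) ∈⊤) , proj₁ (proj₂ (proj₂ (cover g h)))

  γ≤∣layer∣ : ∀ {h} → γ ≤ ∣ layer h ∣
  γ≤∣layer∣ {h} = ≤-trans (γ≤ _ (image-layer-dominating h)) (∣image∣≤ pG (layer h))

  layers-disjoint : PairwiseDisjointOn P layer
  layers-disjoint x∈P y∈P x≢y d∈x d∈y =
    packing _ _ x∈P y∈P x≢y _ (layer-over-nbhd d∈x) (layer-over-nbhd d∈y)

  ⋃-layers⊆D : ⋃-over P layer ⊆ D
  ⋃-layers⊆D d∈⋃ with ∈-⋃-over⁻ P layer d∈⋃
  ... | _ , _ , d∈layer = layer⊆D d∈layer

cartNbhd⇒ˡ : (G H : Digraph) {g : Fin (n G)} {h : Fin (n H)} (p : Fin (n G) × Fin (n H)) →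
             (g , h) ≡ p ⊎ cartArc G H p (g , h) →
             InOutNbhd G (proj₁ p) g × InInNbhd H h (proj₂ p)
cartNbhd⇒ˡ G H p         (inj₁ refl)                = inj₁ refl , inj₁ refl
cartNbhd⇒ˡ G H (g′ , h′) (inj₂ (inj₁ (g′≡g , arc))) = inj₁ (sym g′≡g) , inj₂ arc
cartNbhd⇒ˡ G H (g′ , h′) (inj₂ (inj₂ (h′≡h , arc))) = inj₂ arc , inj₁ h′≡h

cartNbhd⇒ʳ : (G H : Digraph) {g : Fin (n G)} {h : Fin (n H)} (p : Fin (n G) × Fin (n H)) →
             (g , h) ≡ p ⊎ cartArc G H p (g , h) →
             InOutNbhd H (proj₂ p) h × InInNbhd G g (proj₁ p)
cartNbhd⇒ʳ G H p         (inj₁ refl)                = inj₁ refl , inj₁ refl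
cartNbhd⇒ʳ G H (g′ , h′) (inj₂ (inj₁ (g′≡g , arc))) = inj₂ arc , inj₁ g′≡g
cartNbhd⇒ʳ G H (g′ , h′) (inj₂ (inj₂ (h′≡h , arc))) = inj₁ (sym h′≡h) , inj₂ arc

□-nbhd : (G H : Digraph) (g : Fin (n G)) (h : Fin (n H)) {d : Fin (n G * n H)} →
         InOutNbhd (G □ H) d (combine g h) →
         (g , h) ≡ remQuot (n H) d ⊎ cartArc G H (remQuot (n H) d) (g , h)
□-nbhd G H g h (inj₁ e)   = inj₁ (trans (sym (remQuot-combine g h)) (cong (remQuot (n H)) e))
□-nbhd G H g h (inj₂ arc) = inj₂ (subst (cartArc G H _) (remQuot-combine g h) arc)

module _ (G H : Digraph) {D : Subset (n G * n H)} (dom : Dominating (G □ H) D) where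

  dominating□⇒layerDominatingˡ :
    LayerDominating G H (proj₁ ∘ remQuot {n G} (n H)) (proj₂ ∘ remQuot {n G} (n H)) D
  dominating□⇒layerDominatingˡ g h with dom (combine g h)
  ... | d , d∈D , d↦gh = d , d∈D , cartNbhd⇒ˡ G H (remQuot {n G} (n H) d) (□-nbhd G H g h d↦gh)

  dominating□⇒layerDominatingʳ :
    LayerDominating H G (proj₂ ∘ remQuot {n G} (n H)) (proj₁ ∘ remQuot {n G} (n H)) D
  dominating□⇒layerDominatingʳ h g with dom (combine g h)
  ... | d , d∈D , d↦gh = d , d∈D , cartNbhd⇒ʳ G H (remQuot {n G} (n H) d) (□-nbhd G H g h d↦gh)

proposition1p6 : (G H : Digraph) (γG γH ρG ρH γGH : ℕ) →
    IsDominationNumber G γG → IsDominationNumber H γH →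
    IsPackingNumber G ρG → IsPackingNumber H ρH →
    IsDominationNumber (G □ H) γGH →
    (γG * ρH) ⊔ (γH * ρG) ≤ γGH
proposition1p6 G H γG γH _ _ _ (_ , γG≤) (_ , γH≤)
  ((PG , packingG , refl) , _) ((PH , packingH , refl) , _) ((D , dom , refl) , _) =
  ⊔-lub
    (≤-trans (≤-reflexive (*-comm γG ∣ PH ∣))
      (layerDominating⇒∣P∣*γ≤∣D∣ G H γG (dominating□⇒layerDominatingˡ G H dom) γG≤ packingH))
    (≤-trans (≤-reflexive (*-comm γH ∣ PG ∣))
      (layerDominating⇒∣P∣*γ≤∣D∣ H G γH (dominating□⇒layerDominatingʳ G H dom) γH≤ packingG))
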